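{- Let $p\ge 1$ and $n\ge 0$ be integers and let $\mathcal G$ be the configuration graph of the Game of Cards with $p$ players and $n$ cards. Then $\mathcal G$ has at most one strongly connected component containing more than one configuration, and if such a component exists, it is exactly the set of dual configurations.
   Context: Game of Cards: $p$ players sit in a cycle; indices are taken modulo $p$, so the right neighbor of player $i$ is player $i+1$ and the right neighbor of player $p$ is player $1$. A configuration is a vector $a=(a_1,\dots,a_p)$ of nonnegative integers with $\sum_i a_i=n$, where $a_i$ is the number of cards of player $i$. A move at position $i$ is allowed in $a$ iff $a_i>a_{i+1}$ (with $a_{p+1}=a_1$); it produces the configuration in which $a_i$ is replaced by $a_i-1$ and $a_{i+1}$ by $a_{i+1}+1$. The graph $\mathcal G$ has the configurations as vertices and an arc $a\to b$ whenever $b$ is obtained from $a$ by one move. A configuration is called dual if it lies on a directed cycle of positive length in $\mathcal G$. -}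

module Defs where

open import Data.Nat using (ℕ; zero; suc; _<_; _∸_)
open import Data.Nat.DivMod using (_%_; m%n<n)
open import Data.Fin using (Fin; toℕ; fromℕ<)
open import Data.Vec using (Vec; lookup; updateAt; sum)
open import Data.Product using (Σ; ∃; _×_; proj₁)
open import Relation.Binary.PropositionalEquality using (_≡_)
open import Relation.Binary.Construct.Closure.ReflexiveTransitive using (Star)
open import Relation.Binary.Construct.Closure.Transitive using (TransClosure)

next : {p : ℕ} → Fin p → Fin p
next {suc m} i = fromℕ< (m%n<n (suc (toℕ i)) (suc m))

Config : ℕ → ℕ → Set
Config p n = Σ (Vec ℕ p) (λ a → sum a ≡ n)

Move : {p : ℕ} → Vec ℕ p → Vec ℕ p → Set
Move a b = ∃ λ i → (lookup a (next i) < lookup a i)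
                 × (b ≡ updateAt (updateAt a i (λ x → x ∸ 1)) (next i) suc)

_⟶_ : {p n : ℕ} → Config p n → Config p n → Set
a ⟶ b = Move (proj₁ a) (proj₁ b)

Reach : {p n : ℕ} → Config p n → Config p n → Set
Reach = Star _⟶_

SameSCC : {p n : ℕ} → Config p n → Config p n → Set
SameSCC a b = Reach a b × Reach b a

Dual : {p n : ℕ} → Config p n → Set
Dual a = TransClosure _⟶_ a a

-- A configuration on a cycle of moves is balanced: its entries are k and k + 1, and both occur.
-- A move decreases the sum of squares unless it is a swap (x + 1, x) ↦ (x, x + 1), so a cycle
-- consists of swaps. Suppose some entry is at most M − 2, where M is the maximum. Summing,
-- over pairs of an entry M and an entry ≤ M − 2, the cyclic distance from the former to the
-- latter gives a potential that swaps never increase and that drops whenever an M moves.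
-- So on the cycle no M ever moves, a seat holding M is never crossed, and cutting the circle at
-- that seat turns the cycle into moves on a line, which strictly increase Σ i · aᵢ.
-- Conversely, balanced configurations with equal sums reach each other: line moves sort any of
-- them into k … k (k+1) … (k+1), this sorted configuration can be rotated by moves, and a
-- rotation (k+1) … (k+1) k … k spreads by line moves into any balanced configuration.
-- Since n determines k, the dual configurations form one strongly connected component.

module Submission where

open import Defs
open import Data.Empty using (⊥-elim)
open import Data.Fin using (Fin; zero; suc; toℕ; fromℕ; inject₁)
open import Data.Fin.Properties using (toℕ-injective; toℕ-fromℕ<; toℕ-inject₁; toℕ-fromℕ; toℕ<n)
open import Data.Nat using (ℕ; zero; suc; _+_; _*_; _∸_; _≤_; _<_; z≤n; s≤s; s≤s⁻¹; _⊔_)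
open import Data.Nat.DivMod using (_%_; m<n⇒m%n≡m; n%n≡0)
open import Data.Nat.GeneralisedArithmetic using (iterate)
open import Data.Nat.Properties
open import Data.Nat.Tactic.RingSolver using (solve-∀)
open import Algebra.Properties.CommutativeSemigroup +-commutativeSemigroup using (x∙yz≈y∙xz)
open import Data.Product using (∃; ∃₂; _×_; _,_; proj₁; proj₂)
open import Data.Sum using (_⊎_; inj₁; inj₂)
open import Data.Vec using (Vec; []; _∷_; lookup; updateAt; sum; map; init; last; initLast; _∷ʳ_)
open import Data.Vec.Membership.Propositional using (_∈_)
open import Data.Vec.Membership.Propositional.Properties using (∈-lookup)
open import Data.Vec.Relation.Unary.All as All using (All; []; _∷_; all?)
open import Data.Vec.Relation.Unary.Any using (here; there)
open import Data.Vec.Relation.Unary.All.Properties using (lookup⁻)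
open import Data.Vec.Properties using (map-id; lookup∘updateAt′; init-∷ʳ; last-∷ʳ)
open import Function.Base using (id)
open import Function.Bundles using (_⇔_; mk⇔)
open import Relation.Binary.PropositionalEquality
open import Relation.Binary.Construct.Closure.ReflexiveTransitive using (Star; ε; _◅_; _◅◅_; gmap)
open import Relation.Binary.Construct.Closure.Transitive using (TransClosure; [_]; _∷_)
open import Relation.Nullary using (¬_; yes; no)

private variable
  A : Set
  m : ℕ

module _ {B : Set} {R : A → A → Set} where

  ⁺-gmap : {S : B → B → Set} (g : A → B) → (∀ {a b} → R a b → S (g a) (g b)) →
    ∀ {x y} → TransClosure R x y → TransClosure S (g x) (g y)
  ⁺-gmap g f [ r ]    = [ f r ]
  ⁺-gmap g f (r ∷ rs) = f r ∷ ⁺-gmap g f rs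

module _ {R : A → A → Set} where

  ⁺-invariant : (I : A → Set) → (∀ {a b} → R a b → I a → I b) →
    ∀ {x y} → I x → TransClosure R x y → TransClosure (λ a b → R a b × I a) x y
  ⁺-invariant I pres ix [ r ]    = [ r , ix ]
  ⁺-invariant I pres ix (r ∷ rs) = (r , ix) ∷ ⁺-invariant I pres (pres r ix) rs

  ⁺-head : ∀ {x y} → TransClosure R x y → ∃ λ z → R x z
  ⁺-head [ r ]   = _ , r
  ⁺-head (r ∷ _) = _ , r

  ⁺-increasing-acyclic : (V : A → ℕ) → (∀ {a b} → R a b → V a < V b) → ∀ {x} → ¬ TransClosure R x x
  ⁺-increasing-acyclic V inc c = <-irrefl refl (increases c)
    where
    increases : ∀ {x y} → TransClosure R x y → V x < V y
    increases [ r ]    = inc r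
    increases (r ∷ rs) = <-trans (inc r) (increases rs)

  module _ {S : A → A → Set} (V : A → ℕ) (≤-step : ∀ {a b} → R a b → V b ≤ V a)
           (<-or-S : ∀ {a b} → R a b → V b < V a ⊎ S a b) where

    ⁺-descends : ∀ {x y} → TransClosure R x y → V y ≤ V x × (V y < V x ⊎ TransClosure S x y)
    ⁺-descends [ r ] with <-or-S r
    ... | inj₁ lt = ≤-step r , inj₁ lt
    ... | inj₂ s  = ≤-step r , inj₂ [ s ]
    ⁺-descends (r ∷ rs) with ⁺-descends rs | <-or-S r
    ... | le , inj₁ lt | _       = ≤-trans le (≤-step r) , inj₁ (<-≤-trans lt (≤-step r))
    ... | le , inj₂ ss | inj₁ lt = ≤-trans le (≤-step r) , inj₁ (≤-<-trans le lt)
    ... | le , inj₂ ss | inj₂ s  = ≤-trans le (≤-step r) , inj₂ (s ∷ ss)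

    ⁺-cycle-restrict : ∀ {x} → TransClosure R x x → TransClosure S x x
    ⁺-cycle-restrict c with ⁺-descends c
    ... | _ , inj₁ lt = ⊥-elim (<-irrefl refl lt)
    ... | _ , inj₂ ss = ss

  ◅-⁺ : ∀ {x y z} → R x y → Star R y z → TransClosure R x z
  ◅-⁺ r ε        = [ r ]
  ◅-⁺ r (s ◅ ss) = r ∷ ◅-⁺ s ss

  ⁺-◅◅ : ∀ {x y z} → TransClosure R x y → Star R y z → TransClosure R x z
  ⁺-◅◅ [ r ]    ss = ◅-⁺ r ss
  ⁺-◅◅ (r ∷ rs) ss = r ∷ ⁺-◅◅ rs ss

  ◅◅-⁺ : ∀ {x y z} → Star R x y → TransClosure R y z → TransClosure R x z
  ◅◅-⁺ ε        rs = rs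
  ◅◅-⁺ (s ◅ ss) rs = s ∷ ◅◅-⁺ ss rs

sum-∷ʳ : ∀ {n} (v : Vec ℕ n) x → sum (v ∷ʳ x) ≡ sum v + x
sum-∷ʳ []      x = +-identityʳ x
sum-∷ʳ (y ∷ v) x = trans (cong (y +_) (sum-∷ʳ v x)) (sym (+-assoc y (sum v) x))

module _ {P : A → Set} where

  All-init : {v : Vec A (suc m)} → All P v → All P (init v)
  All-init {m = zero}  (px ∷ [])  = []
  All-init {m = suc m} (px ∷ pxs) = px ∷ All-init pxs

  All-last : {v : Vec A (suc m)} → All P v → P (last v)
  All-last {m = zero}  (px ∷ [])  = px
  All-last {m = suc m} (px ∷ pxs) = All-last pxs

  All-∷ʳ : ∀ {n} {v : Vec A n} {x} → All P v → P x → All P (v ∷ʳ x)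
  All-∷ʳ []         px = px ∷ []
  All-∷ʳ (py ∷ pys) px = py ∷ All-∷ʳ pys px

maximum : ∀ {n} → Vec ℕ (suc n) → ℕ
maximum (x ∷ [])    = x
maximum (x ∷ y ∷ v) = x ⊔ maximum (y ∷ v)

lookup≤maximum : ∀ {n} (v : Vec ℕ (suc n)) i → lookup v i ≤ maximum v
lookup≤maximum (x ∷ [])    zero    = ≤-refl
lookup≤maximum (x ∷ y ∷ v) zero    = m≤m⊔n x _
lookup≤maximum (x ∷ y ∷ v) (suc i) = ≤-trans (lookup≤maximum (y ∷ v) i) (m≤n⊔m x _)

maximum-attained : ∀ {n} (v : Vec ℕ (suc n)) → ∃ λ i → lookup v i ≡ maximum v
maximum-attained (x ∷ [])    = zero , refl
maximum-attained (x ∷ y ∷ v) with ⊔-sel x (maximum (y ∷ v))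
... | inj₁ x⊔≡x = zero , sym x⊔≡x
... | inj₂ x⊔≡max with maximum-attained (y ∷ v)
... | i , e = suc i , trans e (sym x⊔≡max)

sum-map-zero : ∀ {n} (f : ℕ → ℕ) (v : Vec ℕ n) → (∀ i → f (lookup v i) ≡ 0) → sum (map f v) ≡ 0
sum-map-zero f []      all-zero = refl
sum-map-zero f (x ∷ v) all-zero = cong₂ _+_ (all-zero zero) (sum-map-zero f v (λ i → all-zero (suc i)))

sum-map-positive : ∀ {n} (f : ℕ → ℕ) (v : Vec ℕ n) i → 1 ≤ f (lookup v i) → 1 ≤ sum (map f v)
sum-map-positive f (x ∷ v) zero    pos = ≤-trans pos (m≤m+n _ _)
sum-map-positive f (x ∷ v) (suc i) pos = ≤-trans (sum-map-positive f v i pos) (m≤n+m _ (f x))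

next-inject₁ : (i : Fin m) → next {suc m} (inject₁ i) ≡ suc i
next-inject₁ {m} i = toℕ-injective (begin
  toℕ (next (inject₁ i))        ≡⟨ toℕ-fromℕ< _ ⟩
  suc (toℕ (inject₁ i)) % suc m ≡⟨ m<n⇒m%n≡m (s≤s i<m) ⟩
  suc (toℕ (inject₁ i))         ≡⟨ cong suc (toℕ-inject₁ i) ⟩
  suc (toℕ i)                   ∎)
  where
  open ≡-Reasoning
  i<m : toℕ (inject₁ i) < m
  i<m = subst (_< m) (sym (toℕ-inject₁ i)) (toℕ<n i)

next-fromℕ : ∀ m → next {suc m} (fromℕ m) ≡ zero
next-fromℕ m = toℕ-injective (trans (toℕ-fromℕ< _)
  (trans (cong (λ x → suc x % suc m) (toℕ-fromℕ m)) (n%n≡0 (suc m))))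

data LastView : Fin (suc m) → Set where
  inner : (i : Fin m) → LastView (inject₁ i)
  final : LastView (fromℕ m)

lastView : (j : Fin (suc m)) → LastView j
lastView {zero}  zero    = final
lastView {suc m} zero    = inner zero
lastView {suc m} (suc j) with lastView j
... | inner i = inner (suc i)
... | final   = final

prev : Fin (suc m) → Fin (suc m)
prev {m} zero = fromℕ m
prev (suc i)  = inject₁ i

prev-next : (j : Fin (suc m)) → prev (next j) ≡ j
prev-next j with lastView j
... | inner i = cong prev (next-inject₁ i)
... | final {m} = cong prev (next-fromℕ m)

next-injective : {i j : Fin (suc m)} → next i ≡ next j → i ≡ j
next-injective {i = i} {j} e = trans (sym (prev-next i)) (trans (cong prev e) (prev-next j))

iterate-next-injective : ∀ d {i j : Fin (suc m)} → iterate next i d ≡ iterate next j d → i ≡ j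
iterate-next-injective zero    e = e
iterate-next-injective (suc d) e = next-injective (iterate-next-injective d e)

iterate-next-fromℕ : ∀ d (i : Fin (suc m)) → toℕ i + d ≡ m → iterate next i d ≡ fromℕ m
iterate-next-fromℕ {m} zero i e = toℕ-injective (trans (trans (sym (+-identityʳ _)) e) (sym (toℕ-fromℕ m)))
iterate-next-fromℕ {m} (suc d) i e with lastView i
... | final = ⊥-elim (m+1+n≢m m (subst (λ x → x + suc d ≡ m) (toℕ-fromℕ m) e))
... | inner i′ = subst (λ x → iterate next x d ≡ fromℕ m) (sym (next-inject₁ i′))
  (iterate-next-fromℕ d (suc i′) (trans (sym (+-suc (toℕ i′) d)) (trans (cong (_+ suc d) (sym (toℕ-inject₁ i′))) e)))

iterate-next-reaches-fromℕ : (i : Fin (suc m)) → ∃ λ d → iterate next i d ≡ fromℕ m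
iterate-next-reaches-fromℕ {m} i = m ∸ toℕ i , iterate-next-fromℕ (m ∸ toℕ i) i (m+[n∸m]≡n (s≤s⁻¹ (toℕ<n i)))

iterate-suc : (f : A → A) (x : A) (d : ℕ) → iterate f x (suc d) ≡ f (iterate f x d)
iterate-suc f x zero    = refl
iterate-suc f x (suc d) = iterate-suc f (f x) d

iterate-next-reaches-zero : (i : Fin (suc m)) → ∃ λ d → iterate next i d ≡ zero
iterate-next-reaches-zero {m} i with iterate-next-reaches-fromℕ i
... | d , e = suc d , trans (iterate-suc next i d) (trans (cong next e) (next-fromℕ m))

rotate : Vec A (suc m) → Vec A (suc m)
rotate v = last v ∷ init v

init-updateAt-inject₁ : (i : Fin m) (v : Vec A (suc m)) (f : A → A) →
  init (updateAt v (inject₁ i) f) ≡ updateAt (init v) i f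
init-updateAt-inject₁ {m = suc m} zero    (x ∷ xs) f = refl
init-updateAt-inject₁ {m = suc m} (suc i) (x ∷ xs) f = cong (x ∷_) (init-updateAt-inject₁ i xs f)

last-updateAt-inject₁ : (i : Fin m) (v : Vec A (suc m)) (f : A → A) →
  last (updateAt v (inject₁ i) f) ≡ last v
last-updateAt-inject₁ {m = suc m} zero    (x ∷ xs) f = refl
last-updateAt-inject₁ {m = suc m} (suc i) (x ∷ xs) f = last-updateAt-inject₁ i xs f

lookup-init : (v : Vec A (suc m)) (i : Fin m) → lookup (init v) i ≡ lookup v (inject₁ i)
lookup-init {m = suc m} (x ∷ xs) zero    = refl
lookup-init {m = suc m} (x ∷ xs) (suc i) = lookup-init xs i

lookup-fromℕ : (v : Vec A (suc m)) → lookup v (fromℕ m) ≡ last v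
lookup-fromℕ {m = zero}  (x ∷ []) = refl
lookup-fromℕ {m = suc m} (x ∷ xs) = lookup-fromℕ xs

updateAt-fromℕ : (v : Vec A (suc m)) (f : A → A) → updateAt v (fromℕ m) f ≡ init v ∷ʳ f (last v)
updateAt-fromℕ {m = zero}  (x ∷ []) f = refl
updateAt-fromℕ {m = suc m} (x ∷ xs) f = cong (x ∷_) (updateAt-fromℕ xs f)

rotate-updateAt : (v : Vec A (suc m)) (j : Fin (suc m)) (f : A → A) →
  rotate (updateAt v j f) ≡ updateAt (rotate v) (next j) f
rotate-updateAt {m = m} v j f with lastView j
... | inner i rewrite next-inject₁ i = cong₂ _∷_ (last-updateAt-inject₁ i v f) (init-updateAt-inject₁ i v f)
... | final   rewrite next-fromℕ m | updateAt-fromℕ v f = cong₂ _∷_ (last-∷ʳ _ (init v)) (init-∷ʳ _ (init v))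

lookup-rotate : (v : Vec A (suc m)) (j : Fin (suc m)) → lookup (rotate v) (next j) ≡ lookup v j
lookup-rotate {m = m} v j with lastView j
... | inner i rewrite next-inject₁ i = lookup-init v i
... | final   rewrite next-fromℕ m   = sym (lookup-fromℕ v)

lookup-iterate-rotate : ∀ d (v : Vec A (suc m)) (i : Fin (suc m)) →
  lookup (iterate rotate v d) (iterate next i d) ≡ lookup v i
lookup-iterate-rotate zero    v i = refl
lookup-iterate-rotate (suc d) v i = trans (lookup-iterate-rotate d (rotate v) (next i)) (lookup-rotate v i)

RotationInvariant : (Vec A (suc m) → ℕ) → Set
RotationInvariant g = ∀ v → g (rotate v) ≡ g v

iterate-rotate-invariant : {g : Vec A (suc m) → ℕ} → RotationInvariant g → ∀ d v → g (iterate rotate v d) ≡ g v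
iterate-rotate-invariant inv zero    v = refl
iterate-rotate-invariant inv (suc d) v = trans (iterate-rotate-invariant inv d (rotate v)) (inv v)

sum-map-rotate : (f : A → ℕ) → RotationInvariant {m = m} (λ v → sum (map f v))
sum-map-rotate {m = zero}  f (x ∷ [])     = refl
sum-map-rotate {m = suc m} f (x ∷ y ∷ xs) = begin
  f (last (y ∷ xs)) + (f x + sum (map f (init (y ∷ xs)))) ≡⟨ x∙yz≈y∙xz (f (last (y ∷ xs))) (f x) _ ⟩
  f x + sum (map f (rotate (y ∷ xs)))                      ≡⟨ cong (f x +_) (sum-map-rotate f (y ∷ xs)) ⟩
  f x + sum (map f (y ∷ xs))                               ∎
  where open ≡-Reasoning

sum-rotate : RotationInvariant {m = m} sum
sum-rotate v = begin
  sum (rotate v)          ≡⟨ cong sum (map-id (rotate v)) ⟨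
  sum (map id (rotate v)) ≡⟨ sum-map-rotate id v ⟩
  sum (map id v)          ≡⟨ cong sum (map-id v) ⟩
  sum v                   ∎
  where open ≡-Reasoning

MoveAt : ∀ {p} → Fin p → Vec ℕ p → Vec ℕ p → Set
MoveAt i a b = (lookup a (next i) < lookup a i) × (b ≡ updateAt (updateAt a i (λ x → x ∸ 1)) (next i) suc)

rotate-MoveAt : {i : Fin (suc m)} {a b : Vec ℕ (suc m)} → MoveAt i a b → MoveAt (next i) (rotate a) (rotate b)
rotate-MoveAt {i = i} {a} (lt , refl) =
  subst₂ _<_ (sym (lookup-rotate a (next i))) (sym (lookup-rotate a i)) lt ,
  trans (rotate-updateAt _ (next i) suc) (cong (λ w → updateAt w (next (next i)) suc) (rotate-updateAt a i _))

iterate-rotate-MoveAt : ∀ d {i : Fin (suc m)} {a b} → MoveAt i a b →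
  MoveAt (iterate next i d) (iterate rotate a d) (iterate rotate b d)
iterate-rotate-MoveAt zero    mv = mv
iterate-rotate-MoveAt (suc d) mv = iterate-rotate-MoveAt d (rotate-MoveAt mv)

rotate-Move⋆ : ∀ d {a b : Vec ℕ (suc m)} → Star Move a b → Star Move (iterate rotate a d) (iterate rotate b d)
rotate-Move⋆ d = gmap (λ v → iterate rotate v d) (λ (i , mv) → iterate next i d , iterate-rotate-MoveAt d mv)

rotation-chain : {S : Vec ℕ (suc m)} → Star Move S (rotate S) → ∀ j → Star Move S (iterate rotate S j)
rotation-chain S↝rotate-S zero    = ε
rotation-chain S↝rotate-S (suc j) = rotation-chain S↝rotate-S j ◅◅ rotate-Move⋆ j S↝rotate-S

MoveAt-zero : {a b : Vec ℕ (suc (suc m))} → MoveAt zero a b →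
  ∃ λ t → a ≡ lookup a zero ∷ lookup a (suc zero) ∷ t × b ≡ (lookup a zero ∸ 1) ∷ suc (lookup a (suc zero)) ∷ t
MoveAt-zero {m} {x ∷ y ∷ t} (_ , eq) rewrite next-inject₁ {suc m} zero = t , refl , eq

MoveAt-to-front : {i : Fin (suc (suc m))} {a b : Vec ℕ (suc (suc m))} → MoveAt i a b →
  ∃₂ λ d t → iterate rotate a d ≡ lookup a i ∷ lookup a (next i) ∷ t
           × iterate rotate b d ≡ (lookup a i ∸ 1) ∷ suc (lookup a (next i)) ∷ t
MoveAt-to-front {m} {i} {a} {b} mv with iterate-next-reaches-zero i
... | d , i↦0
  with MoveAt-zero (subst (λ j → MoveAt j (iterate rotate a d) (iterate rotate b d)) i↦0 (iterate-rotate-MoveAt d mv))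
... | t , ea , eb =
  d , t , trans ea (cong₂ (λ u w → u ∷ w ∷ t) x≡ y≡) , trans eb (cong₂ (λ u w → (u ∸ 1) ∷ suc w ∷ t) x≡ y≡)
  where
  x≡ : lookup (iterate rotate a d) zero ≡ lookup a i
  x≡ = trans (cong (lookup (iterate rotate a d)) (sym i↦0)) (lookup-iterate-rotate d a i)
  next-i↦1 : iterate next (next i) d ≡ suc zero
  next-i↦1 = trans (iterate-suc next i d) (trans (cong next i↦0) (next-inject₁ {suc m} zero))
  y≡ : lookup (iterate rotate a d) (suc zero) ≡ lookup a (next i)
  y≡ = trans (cong (lookup (iterate rotate a d)) (sym next-i↦1)) (lookup-iterate-rotate d a (next i))

MoveAt-invariant : {g : Vec ℕ (suc (suc m)) → ℕ} → RotationInvariant g →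
  {i : Fin (suc (suc m))} {a b : Vec ℕ (suc (suc m))} → MoveAt i a b →
  ∃ λ t → g a ≡ g (lookup a i ∷ lookup a (next i) ∷ t) × g b ≡ g ((lookup a i ∸ 1) ∷ suc (lookup a (next i)) ∷ t)
MoveAt-invariant {g = g} inv mv with MoveAt-to-front mv
... | d , t , ea , eb = t , trans (sym (iterate-rotate-invariant inv d _)) (cong g ea)
                          , trans (sym (iterate-rotate-invariant inv d _)) (cong g eb)

move-preserves-sum : {a b : Vec ℕ (suc (suc m))} → Move a b → sum b ≡ sum a
move-preserves-sum {a = a} (i , mv) with MoveAt-invariant sum-rotate mv
... | t , ea , eb = trans eb (trans (shift (proj₁ mv)) (sym ea))
  where
  shift : ∀ {x y} → y < x → (x ∸ 1) + (suc y + sum t) ≡ x + (y + sum t)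
  shift {suc x} {y} _ = +-suc x (y + sum t)

data LineMove : ∀ {n} → Vec ℕ n → Vec ℕ n → Set where
  here  : ∀ {n x y} {t : Vec ℕ n} → y < x → LineMove (x ∷ y ∷ t) ((x ∸ 1) ∷ suc y ∷ t)
  there : ∀ {n x} {t t′ : Vec ℕ n} → LineMove t t′ → LineMove (x ∷ t) (x ∷ t′)

LineMove-at : {a b : Vec ℕ (suc m)} → LineMove a b →
  ∃ λ i → lookup a (suc i) < lookup a (inject₁ i) × b ≡ updateAt (updateAt a (inject₁ i) (λ x → x ∸ 1)) (suc i) suc
LineMove-at (here y<x) = zero , y<x , refl
LineMove-at {suc m} (there {t = _ ∷ _} mv) with LineMove-at mv
... | i , lt , refl = suc i , lt , refl

LineMove⇒Move : {a b : Vec ℕ (suc m)} → LineMove a b → Move a b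
LineMove⇒Move mv with LineMove-at mv
... | i , lt , eq rewrite sym (next-inject₁ i) = inject₁ i , lt , eq

MoveAt⇒LineMove : {j : Fin (suc m)} {a b : Vec ℕ (suc m)} → MoveAt j a b → j ≢ fromℕ m → LineMove a b
MoveAt⇒LineMove {j = j} {a} (lt , refl) j≢last with lastView j
... | final   = ⊥-elim (j≢last refl)
... | inner i rewrite next-inject₁ i = build i a lt
  where
  build : ∀ {m} (i : Fin m) (a : Vec ℕ (suc m)) → lookup a (suc i) < lookup a (inject₁ i) →
    LineMove a (updateAt (updateAt a (inject₁ i) (λ x → x ∸ 1)) (suc i) suc)
  build zero    (x ∷ y ∷ t) lt = here lt
  build (suc i) (x ∷ a)     lt = there (build i a lt)

LineMove-sum : ∀ {n} {a b : Vec ℕ n} → LineMove a b → sum b ≡ sum a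
LineMove-sum (here {x = suc x} {y} {t} _) = +-suc x (y + sum t)
LineMove-sum (there {x = x} mv)           = cong (x +_) (LineMove-sum mv)

-- moment v = Σ i · vᵢ
moment : ∀ {n} → Vec ℕ n → ℕ
moment []      = 0
moment (x ∷ t) = moment t + sum t

LineMove-moment : ∀ {n} {a b : Vec ℕ n} → LineMove a b → moment a < moment b
LineMove-moment (here {t = t} _) = +-monoʳ-< (moment t + sum t) ≤-refl
LineMove-moment (there mv) rewrite LineMove-sum mv = +-monoˡ-< _ (LineMove-moment mv)

LineMove⋆-∷ : ∀ {n} x {t t′ : Vec ℕ n} → Star LineMove t t′ → Star LineMove (x ∷ t) (x ∷ t′)
LineMove⋆-∷ x = gmap (x ∷_) there

LineMove⋆-sum : ∀ {n} {a b : Vec ℕ n} → Star LineMove a b → sum b ≡ sum a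
LineMove⋆-sum ε        = refl
LineMove⋆-sum (mv ◅ s) = trans (LineMove⋆-sum s) (LineMove-sum mv)

SwapAt : ∀ {p} → Fin p → Vec ℕ p → Vec ℕ p → Set
SwapAt i a b = MoveAt i a b × lookup a i ≡ suc (lookup a (next i))

Swap : ∀ {p} → Vec ℕ p → Vec ℕ p → Set
Swap a b = ∃ λ i → SwapAt i a b

square : ℕ → ℕ
square x = x * x

square-exchange : ∀ {x y} s → y < x →
  square (x ∸ 1) + (square (suc y) + s) + 2 * (x ∸ suc y) ≡ square x + (square y + s)
square-exchange {x} {y} s y<x with m≤n⇒∃[o]m+o≡n y<x
... | d , refl rewrite m+n∸m≡n y d = identity y d s
  where
  identity : ∀ y d s → (y + d) * (y + d) + (suc y * suc y + s) + 2 * d ≡ suc (y + d) * suc (y + d) + (y * y + s)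
  identity = solve-∀

squares : ∀ {p} → Vec ℕ p → ℕ
squares v = sum (map square v)

squares-move : {a b : Vec ℕ (suc (suc m))} → Move a b → squares b ≤ squares a × (squares b < squares a ⊎ Swap a b)
squares-move {a = a} {b} (i , mv) with MoveAt-invariant (sum-map-rotate square) mv
... | t , ea , eb = ≤-trans (m≤m+n _ _) (≤-reflexive balance) , strict-or-swap (x ∸ suc y) refl
  where
  x = lookup a i
  y = lookup a (next i)
  balance : squares b + 2 * (x ∸ suc y) ≡ squares a
  balance = trans (cong (_+ 2 * (x ∸ suc y)) eb) (trans (square-exchange (squares t) (proj₁ mv)) (sym ea))
  strict-or-swap : ∀ d → x ∸ suc y ≡ d → squares b < squares a ⊎ Swap a b
  strict-or-swap zero    e = inj₂ (i , mv , ≤-antisym (m∸n≡0⇒m≤n e) (proj₁ mv))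
  strict-or-swap (suc d) e = inj₁ (subst (squares b <_) (trans (cong (λ d → squares b + 2 * d) (sym e)) balance)
                                     (m<m+n (squares b) (s≤s z≤n)))

cycle-of-swaps : {c : Vec ℕ (suc (suc m))} → TransClosure Move c c → TransClosure Swap c c
cycle-of-swaps = ⁺-cycle-restrict squares (λ r → proj₁ (squares-move r)) (λ r → proj₂ (squares-move r))

SwapAt-to-front : {i : Fin (suc (suc m))} {a b : Vec ℕ (suc (suc m))} → SwapAt i a b →
  ∃₂ λ d t → iterate rotate a d ≡ suc (lookup a (next i)) ∷ lookup a (next i) ∷ t
           × iterate rotate b d ≡ lookup a (next i) ∷ suc (lookup a (next i)) ∷ t
SwapAt-to-front (mv , e) with MoveAt-to-front mv
... | d , t , ea , eb rewrite e = d , t , ea , eb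

swap-preserves-sum-map : (f : ℕ → ℕ) {a b : Vec ℕ (suc (suc m))} → Swap a b → sum (map f b) ≡ sum (map f a)
swap-preserves-sum-map f {a} {b} (i , sw) with SwapAt-to-front sw
... | d , t , ea , eb = begin
  Σf b                              ≡⟨ iterate-rotate-invariant (sum-map-rotate f) d b ⟨
  Σf (iterate rotate b d)           ≡⟨ cong Σf eb ⟩
  f y + (f (suc y) + Σf t)          ≡⟨ x∙yz≈y∙xz (f y) (f (suc y)) (Σf t) ⟩
  f (suc y) + (f y + Σf t)          ≡⟨ cong Σf ea ⟨
  Σf (iterate rotate a d)           ≡⟨ iterate-rotate-invariant (sum-map-rotate f) d a ⟩
  Σf a                              ∎
  where
  open ≡-Reasoning
  y = lookup a (next i)
  Σf : ∀ {n} → Vec ℕ n → ℕ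
  Σf v = sum (map f v)

SwapBelow : ∀ {p} → ℕ → Vec ℕ p → Vec ℕ p → Set
SwapBelow M a b = ∃ λ i → SwapAt i a b × lookup a i < M

data Kind : Set where
  top mid low : Kind

module SpreadPotential (m M : ℕ) where

  p : ℕ
  p = suc (suc m)

  kind : ℕ → Kind
  kind x with x ≟ M | suc (suc x) ≤? M
  ... | yes _ | _     = top
  ... | no _  | yes _ = low
  ... | no _  | no _  = mid

  kind-top : ∀ {x} → x ≡ M → kind x ≡ top
  kind-top {x} x≡M with x ≟ M
  ... | yes _   = refl
  ... | no x≢M = ⊥-elim (x≢M x≡M)

  kind-low : ∀ {x} → suc (suc x) ≤ M → kind x ≡ low
  kind-low {x} 2+x≤M with x ≟ M | suc (suc x) ≤? M
  ... | yes refl | _       = ⊥-elim (1+n≰n (≤-trans (n≤1+n (suc x)) 2+x≤M))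
  ... | no _     | yes _   = refl
  ... | no _     | no 2+x≰M = ⊥-elim (2+x≰M 2+x≤M)

  kind-mid : ∀ {x} → suc x ≡ M → kind x ≡ mid
  kind-mid {x} refl with x ≟ suc x | suc (suc x) ≤? suc x
  ... | yes x≡1+x | _         = ⊥-elim (1+n≢n (sym x≡1+x))
  ... | no _      | yes 2+x≤1+x = ⊥-elim (1+n≰n 2+x≤1+x)
  ... | no _      | no _      = refl

  -- potential v sums weight over all pairs of entries, where d is the distance from the first
  -- entry of the pair to the second; weight (top , low) is the cyclic distance from the top entry
  -- forward to the low one. row k t o handles the pairs formed by an entry of kind k and the
  -- entries of t at distances o, o + 1, …, and column v y the pairs of entries of v with a last entry y.
  weight : Kind → Kind → ℕ → ℕ
  weight top low d = d
  weight low top d = p ∸ d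
  weight _   _   _ = 0

  row : ∀ {n} → Kind → Vec ℕ n → ℕ → ℕ
  row k []      o = 0
  row k (y ∷ t) o = weight k (kind y) o + row k t (suc o)

  potential : ∀ {n} → Vec ℕ n → ℕ
  potential []      = 0
  potential (x ∷ t) = row (kind x) t 1 + potential t

  column : ∀ {n} → Vec ℕ n → ℕ → ℕ
  column []              y = 0
  column {suc n} (x ∷ v) y = weight (kind x) (kind y) (suc n) + column v y

  weight-swap : ∀ k k′ {d} → d ≤ p → weight k k′ d ≡ weight k′ k (p ∸ d)
  weight-swap top low d≤p = sym (m∸[m∸n]≡n d≤p)
  weight-swap low top d≤p = refl
  weight-swap top top _ = refl
  weight-swap top mid _ = refl
  weight-swap mid top _ = refl
  weight-swap mid mid _ = refl
  weight-swap mid low _ = refl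
  weight-swap low mid _ = refl
  weight-swap low low _ = refl

  row-∷ʳ : ∀ {n} k (v : Vec ℕ n) y o → row k (v ∷ʳ y) o ≡ row k v o + weight k (kind y) (o + n)
  row-∷ʳ k []      y o = trans (+-identityʳ _) (cong (weight k (kind y)) (sym (+-identityʳ o)))
  row-∷ʳ {suc n} k (x ∷ v) y o rewrite row-∷ʳ k v y (suc o) | +-suc o n =
    sym (+-assoc (weight k (kind x) o) _ _)

  potential-∷ʳ : ∀ {n} (v : Vec ℕ n) y → potential (v ∷ʳ y) ≡ potential v + column v y
  potential-∷ʳ []              y = refl
  potential-∷ʳ {suc n} (x ∷ v) y rewrite row-∷ʳ (kind x) v y 1 | potential-∷ʳ v y =
    [a+b]+[c+d]≡[a+c]+[b+d] (row (kind x) v 1) _ (potential v) _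
    where
    [a+b]+[c+d]≡[a+c]+[b+d] : ∀ a b c d → (a + b) + (c + d) ≡ (a + c) + (b + d)
    [a+b]+[c+d]≡[a+c]+[b+d] = solve-∀

  row-column : ∀ {n} y (v : Vec ℕ n) o → o + n ≡ p → row (kind y) v o ≡ column v y
  row-column y []              o _ = refl
  row-column {suc n} y (x ∷ v) o o+n≡p = cong₂ _+_ swapped (row-column y v (suc o) (trans (sym (+-suc o n)) o+n≡p))
    where
    swapped : weight (kind y) (kind x) o ≡ weight (kind x) (kind y) (suc n)
    swapped = trans (weight-swap (kind y) (kind x) (subst (o ≤_) o+n≡p (m≤m+n o (suc n))))
                    (cong (weight (kind x) (kind y)) (trans (cong (_∸ o) (sym o+n≡p)) (m+n∸m≡n o (suc n))))

  potential-rotate : RotationInvariant potential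
  potential-rotate v = begin
    row (kind (last v)) (init v) 1 + potential (init v) ≡⟨ cong (_+ potential (init v)) (row-column (last v) (init v) 1 refl) ⟩
    column (init v) (last v) + potential (init v)       ≡⟨ +-comm (column (init v) (last v)) _ ⟩
    potential (init v) + column (init v) (last v)       ≡⟨ potential-∷ʳ (init v) (last v) ⟨
    potential (init v ∷ʳ last v)                        ≡⟨ cong potential (proj₂ (proj₂ (initLast v))) ⟨
    potential v                                         ∎
    where open ≡-Reasoning

  isTop isLow : Kind → ℕ
  isTop top = 1
  isTop _   = 0
  isLow low = 1
  isLow _   = 0

  tops lows : ∀ {n} → Vec ℕ n → ℕ
  tops v = sum (map (λ x → isTop (kind x)) v)
  lows v = sum (map (λ x → isLow (kind x)) v)

  row-mid : ∀ {n} (t : Vec ℕ n) o → row mid t o ≡ 0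
  row-mid []      o = refl
  row-mid (y ∷ t) o = row-mid t (suc o)

  row-top : ∀ {n} (t : Vec ℕ n) o → row top t (suc o) ≡ row top t o + lows t
  row-top []      o = refl
  row-top (y ∷ t) o rewrite row-top t (suc o) with kind y
  ... | top = refl
  ... | mid = refl
  ... | low = shift o (row top t (suc o)) (lows t)
    where
    shift : ∀ o r l → suc o + (r + l) ≡ (o + r) + (1 + l)
    shift = solve-∀

  row-low : ∀ {n} (t : Vec ℕ n) o → suc (o + n) ≤ p → row low t o ≡ row low t (suc o) + tops t
  row-low []      o _ = refl
  row-low {suc n} (y ∷ t) o o+n<p rewrite row-low t (suc o) (subst (λ z → suc z ≤ p) (+-suc o n) o+n<p) with kind y
  ... | mid = refl
  ... | low = refl
  ... | top rewrite +-∸-assoc 1 {p} {suc o} (≤-trans (s≤s (m≤m+n o (suc n))) o+n<p) =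
    shift (p ∸ suc o) (row low t (suc (suc o))) (tops t)
    where
    shift : ∀ w r c → suc w + (r + c) ≡ (w + r) + (1 + c)
    shift = solve-∀

  potential-swap-top : ∀ y (t : Vec ℕ m) → suc y ≡ M →
    potential (y ∷ suc y ∷ t) + lows t ≡ potential (suc y ∷ y ∷ t)
  potential-swap-top y t 1+y≡M rewrite kind-top 1+y≡M | kind-mid 1+y≡M | row-mid t 1 | row-mid t 2 | row-top t 1 =
    rearrange (row top t 1) (potential t) (lows t)
    where
    rearrange : ∀ r q l → (r + q) + l ≡ (r + l) + q
    rearrange = solve-∀

  potential-swap-below-top : ∀ y (t : Vec ℕ m) → suc y < M → potential (y ∷ suc y ∷ t) ≤ potential (suc y ∷ y ∷ t)
  potential-swap-below-top y t 2+y≤M with suc (suc y) ≟ M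
  ... | yes 2+y≡M rewrite kind-mid 2+y≡M | kind-low 2+y≤M | row-mid t 1 | row-mid t 2 | row-low t 1 ≤-refl =
    +-monoˡ-≤ (potential t) (m≤m+n (row low t 2) (tops t))
  ... | no 2+y≢M rewrite kind-low (≤∧≢⇒< 2+y≤M 2+y≢M) | kind-low 2+y≤M = ≤-refl

  above : ℕ → ℕ
  above x with M <? x
  ... | yes _ = 1
  ... | no _  = 0

  above-zero : ∀ {x} → above x ≡ 0 → x ≤ M
  above-zero {x} e with M <? x
  ... | no M≮x = ≮⇒≥ M≮x

  above-≤ : ∀ {x} → x ≤ M → above x ≡ 0
  above-≤ {x} x≤M with M <? x
  ... | yes M<x = ⊥-elim (<⇒≱ M<x x≤M)
  ... | no _    = refl

  aboves : ∀ {n} → Vec ℕ n → ℕ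
  aboves v = sum (map above v)

  Spread : Vec ℕ p → Set
  Spread a = aboves a ≡ 0 × 1 ≤ lows a

  swap-preserves-Spread : {a b : Vec ℕ p} → Swap a b → Spread a → Spread b
  swap-preserves-Spread sw (a-bounded , a-low) =
    trans (swap-preserves-sum-map above sw) a-bounded ,
    subst (1 ≤_) (sym (swap-preserves-sum-map (λ x → isLow (kind x)) sw)) a-low

  -- A swap moves an M forward past an M − 1 (the potential drops by lows t), moves an M − 2
  -- backward past an M − 1 (it drops by tops t), or exchanges two low entries (it is unchanged).
  potential-swap-front : ∀ y (t : Vec ℕ m) → Spread (suc y ∷ y ∷ t) →
    potential (y ∷ suc y ∷ t) ≤ potential (suc y ∷ y ∷ t) ×
    (potential (y ∷ suc y ∷ t) < potential (suc y ∷ y ∷ t) ⊎ suc y < M)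
  potential-swap-front y t (bounded , has-low) with m≤n⇒m<n∨m≡n (above-zero (m+n≡0⇒m≡0 _ bounded))
  ... | inj₁ 1+y<M = potential-swap-below-top y t 1+y<M , inj₂ 1+y<M
  ... | inj₂ 1+y≡M = <⇒≤ decrease , inj₁ decrease
    where
    t-low : 1 ≤ lows t
    t-low = subst (1 ≤_) (cong₂ (λ k k′ → isLow k + (isLow k′ + lows t)) (kind-top 1+y≡M) (kind-mid 1+y≡M)) has-low
    decrease : potential (y ∷ suc y ∷ t) < potential (suc y ∷ y ∷ t)
    decrease = subst (potential (y ∷ suc y ∷ t) <_) (potential-swap-top y t 1+y≡M) (m<m+n _ t-low)

  iterate-rotate-Spread : ∀ d {a : Vec ℕ p} → Spread a → Spread (iterate rotate a d)
  iterate-rotate-Spread d {a} (bounded , has-low) =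
    trans (iterate-rotate-invariant (sum-map-rotate above) d a) bounded ,
    subst (1 ≤_) (sym (iterate-rotate-invariant (sum-map-rotate (λ x → isLow (kind x))) d a)) has-low

  potential-swap : {a b : Vec ℕ p} → Swap a b → Spread a →
    potential b ≤ potential a × (potential b < potential a ⊎ SwapBelow M a b)
  potential-swap {a} {b} (i , sw) a-spread with SwapAt-to-front sw
  ... | d , t , ea , eb with potential-swap-front (lookup a (next i)) t (subst Spread ea (iterate-rotate-Spread d a-spread))
  ... | le , lt-or-below = subst₂ _≤_ (sym pb) (sym pa) le , conclude lt-or-below
    where
    pa : potential a ≡ _
    pa = trans (sym (iterate-rotate-invariant potential-rotate d a)) (cong potential ea)
    pb : potential b ≡ _
    pb = trans (sym (iterate-rotate-invariant potential-rotate d b)) (cong potential eb)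
    conclude : _ ⊎ _ → potential b < potential a ⊎ SwapBelow M a b
    conclude (inj₁ lt)    = inj₁ (subst₂ _<_ (sym pb) (sym pa) lt)
    conclude (inj₂ 1+y<M) = inj₂ (i , sw , subst (_< M) (sym (proj₂ sw)) 1+y<M)

  cycle-of-swaps-below : {c : Vec ℕ p} → TransClosure Swap c c → Spread c → TransClosure (SwapBelow M) c c
  cycle-of-swaps-below cyc c-spread =
    ⁺-cycle-restrict potential (λ (sw , s) → proj₁ (potential-swap sw s)) (λ (sw , s) → proj₂ (potential-swap sw s))
      (⁺-invariant Spread swap-preserves-Spread c-spread cyc)

-- The entry M at x₀ is never touched, so after rotating x₀ to the last seat all moves are line moves.
no-cycle-of-swaps-below-max : ∀ {M} {c : Vec ℕ (suc (suc m))} (x₀ : Fin (suc (suc m))) → lookup c x₀ ≡ M →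
  ¬ TransClosure (SwapBelow M) c c
no-cycle-of-swaps-below-max {m} {M} {c} x₀ c-x₀ cyc =
  ⁺-increasing-acyclic {R = LineMove} moment LineMove-moment (⁺-gmap shift line-move (⁺-invariant Fixed preserves c-x₀ cyc))
  where
  V = Vec ℕ (suc (suc m))
  Fixed : V → Set
  Fixed a = lookup a x₀ ≡ M
  preserves : {a b : V} → SwapBelow M a b → Fixed a → Fixed b
  preserves {a} (i , ((y<x , refl) , _) , x<M) a-x₀ =
    trans (lookup∘updateAt′ x₀ (next i) x₀≢next-i (updateAt a i (λ x → x ∸ 1)))
          (trans (lookup∘updateAt′ x₀ i x₀≢i a) a-x₀)
    where
    x₀≢i : x₀ ≢ i
    x₀≢i refl = <-irrefl a-x₀ x<M
    x₀≢next-i : x₀ ≢ next i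
    x₀≢next-i refl = <-irrefl a-x₀ (<-trans y<x x<M)
  d = proj₁ (iterate-next-reaches-fromℕ x₀)
  shift : V → V
  shift v = iterate rotate v d
  line-move : {a b : V} → SwapBelow M a b × Fixed a → LineMove (shift a) (shift b)
  line-move {a} ((i , (mv , _) , x<M) , a-x₀) =
    MoveAt⇒LineMove (iterate-rotate-MoveAt d mv)
      (λ e → i≢x₀ (iterate-next-injective d (trans e (sym (proj₂ (iterate-next-reaches-fromℕ x₀))))))
    where
    i≢x₀ : i ≢ x₀
    i≢x₀ refl = <-irrefl a-x₀ x<M

TwoValued : ∀ {n} → ℕ → Vec ℕ n → Set
TwoValued k = All (λ x → x ≡ k ⊎ x ≡ suc k)

Balanced : ∀ {n} → ℕ → Vec ℕ n → Set
Balanced k v = TwoValued k v × k ∈ v × suc k ∈ v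

cycle-near-maximum : {c : Vec ℕ (suc (suc m))} → TransClosure Move c c → ∀ i → maximum c ≤ suc (lookup c i)
cycle-near-maximum {m} {c} cyc i with suc (suc (lookup c i)) ≤? maximum c
... | no 2+cᵢ≰M = s≤s⁻¹ (≰⇒> 2+cᵢ≰M)
... | yes 2+cᵢ≤M =
  ⊥-elim (no-cycle-of-swaps-below-max x₀ c-x₀ (cycle-of-swaps-below (cycle-of-swaps cyc) (bounded , has-low)))
  where
  open SpreadPotential m (maximum c)
  x₀ = proj₁ (maximum-attained c)
  c-x₀ = proj₂ (maximum-attained c)
  bounded : aboves c ≡ 0
  bounded = sum-map-zero above c (λ j → above-≤ (lookup≤maximum c j))
  has-low : 1 ≤ lows c
  has-low = sum-map-positive (λ x → isLow (kind x)) c i (≤-reflexive (sym (cong isLow (kind-low 2+cᵢ≤M))))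

cycle-balanced : {c : Vec ℕ (suc (suc m))} → TransClosure Move c c → ∃ λ k → Balanced k c
cycle-balanced {m} {c} cyc with ⁺-head cyc | maximum-attained c
... | _ , i , y<x , _ | x₀ , c-x₀ =
  y , lookup⁻ two-valued , ∈-lookup (next i) c , subst (_∈ c) (trans c-x₀ M≡1+y) (∈-lookup x₀ c)
  where
  y = lookup c (next i)
  M≡1+y : maximum c ≡ suc y
  M≡1+y = ≤-antisym (cycle-near-maximum cyc (next i)) (≤-trans y<x (lookup≤maximum c i))
  two-valued : ∀ j → lookup c j ≡ y ⊎ lookup c j ≡ suc y
  two-valued j with m≤n⇒m<n∨m≡n (subst (lookup c j ≤_) M≡1+y (lookup≤maximum c j))
  ... | inj₁ cⱼ<1+y =
    inj₁ (≤-antisym (s≤s⁻¹ cⱼ<1+y) (s≤s⁻¹ (subst (_≤ suc (lookup c j)) M≡1+y (cycle-near-maximum cyc j))))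
  ... | inj₂ cⱼ≡1+y = inj₂ cⱼ≡1+y

module TwoValuedReachability (k : ℕ) where

  -- Ascending c v : v = k … k (k+1) … (k+1) with c entries k + 1;  Descending v : v = (k+1) … (k+1) k … k.
  data Ascending : ℕ → ∀ {n} → Vec ℕ n → Set where
    highs : ∀ {c} {v : Vec ℕ c} → All (_≡ suc k) v → Ascending c v
    low∷  : ∀ {c n} {v : Vec ℕ n} → Ascending c v → Ascending c (k ∷ v)

  data Descending : ∀ {n} → Vec ℕ n → Set where
    lows   : ∀ {n} {v : Vec ℕ n} → All (_≡ k) v → Descending v
    high∷  : ∀ {n} {v : Vec ℕ n} → Descending v → Descending (suc k ∷ v)

  insert-high : ∀ {c n} {s : Vec ℕ n} → Ascending c s →
    ∃ λ s′ → Star LineMove (suc k ∷ s) s′ × Ascending (suc c) s′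
  insert-high (highs all-high) = _ , ε , highs (refl ∷ all-high)
  insert-high (low∷ asc) with insert-high asc
  ... | s′ , moves , asc′ = k ∷ s′ , here ≤-refl ◅ LineMove⋆-∷ k moves , low∷ asc′

  sort : ∀ {n} {v : Vec ℕ n} → TwoValued k v → ∃₂ λ c s → Star LineMove v s × Ascending c s
  sort [] = 0 , [] , ε , highs []
  sort (near ∷ near*) with sort near*
  sort (inj₁ refl ∷ _) | c , s , moves , asc = c , k ∷ s , LineMove⋆-∷ k moves , low∷ asc
  sort (inj₂ refl ∷ _) | c , s , moves , asc with insert-high asc
  ... | s′ , moves′ , asc′ = suc c , s′ , LineMove⋆-∷ (suc k) moves ◅◅ moves′ , asc′

  sum-highs : ∀ {n} {v : Vec ℕ n} → All (_≡ suc k) v → sum v ≡ n * suc k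
  sum-highs []                = refl
  sum-highs (refl ∷ all-high) = cong (suc k +_) (sum-highs all-high)

  sum-lows : ∀ {n} {v : Vec ℕ n} → All (_≡ k) v → sum v ≡ n * k
  sum-lows []               = refl
  sum-lows (refl ∷ all-low) = cong (k +_) (sum-lows all-low)

  sum-≤ : ∀ {n} {v : Vec ℕ n} → TwoValued k v → sum v ≤ n * suc k
  sum-≤ []               = z≤n
  sum-≤ (inj₁ refl ∷ tv) = +-mono-≤ (n≤1+n k) (sum-≤ tv)
  sum-≤ (inj₂ refl ∷ tv) = +-monoʳ-≤ (suc k) (sum-≤ tv)

  sum-≥ : ∀ {n} {v : Vec ℕ n} → TwoValued k v → n * k ≤ sum v
  sum-≥ []               = z≤n
  sum-≥ (inj₁ refl ∷ tv) = +-monoʳ-≤ k (sum-≥ tv)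
  sum-≥ (inj₂ refl ∷ tv) = +-mono-≤ (n≤1+n k) (sum-≥ tv)

  sum-< : ∀ {n} {v : Vec ℕ n} → TwoValued k v → k ∈ v → sum v < n * suc k
  sum-< (_ ∷ tv)    (here refl) = s≤s (+-monoʳ-≤ k (sum-≤ tv))
  sum-< (near ∷ tv) (there k∈v) = +-mono-≤-< (≤-upper near) (sum-< tv k∈v)
    where
    ≤-upper : ∀ {x} → x ≡ k ⊎ x ≡ suc k → x ≤ suc k
    ≤-upper (inj₁ refl) = n≤1+n k
    ≤-upper (inj₂ refl) = ≤-refl

  sum-> : ∀ {n} {v : Vec ℕ n} → TwoValued k v → suc k ∈ v → n * k < sum v
  sum-> (_ ∷ tv)    (here refl)   = s≤s (+-monoʳ-≤ k (sum-≥ tv))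
  sum-> (near ∷ tv) (there 1+k∈v) = +-mono-≤-< (≥-lower near) (sum-> tv 1+k∈v)
    where
    ≥-lower : ∀ {x} → x ≡ k ⊎ x ≡ suc k → k ≤ x
    ≥-lower (inj₁ refl) = ≤-refl
    ≥-lower (inj₂ refl) = n≤1+n k

  lows<TwoValued : ∀ {n} {v w : Vec ℕ n} → All (_≡ k) v → TwoValued k w → k + sum v < suc k + sum w
  lows<TwoValued {w = w} all-low tv = s≤s (+-monoʳ-≤ k (subst (_≤ sum w) (sym (sum-lows all-low)) (sum-≥ tv)))

  TwoValued<highs : ∀ {n} {v w : Vec ℕ n} → TwoValued k v → All (_≡ suc k) w → k + sum v < suc k + sum w
  TwoValued<highs {v = v} tv all-high = s≤s (+-monoʳ-≤ k (subst (sum v ≤_) (sym (sum-highs all-high)) (sum-≤ tv)))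

  Descending-shift : ∀ {n} {z : Vec ℕ (suc n)} → Descending z → ¬ All (_≡ suc k) z →
    ∃ λ z′ → Star LineMove z (k ∷ z′) × Descending z′
  Descending-shift (lows (refl ∷ all-low)) _ = _ , ε , lows all-low
  Descending-shift {zero} (high∷ {v = []} _) not-all-high = ⊥-elim (not-all-high (refl ∷ []))
  Descending-shift {suc n} (high∷ desc) not-all-high with Descending-shift desc (λ all-high → not-all-high (refl ∷ all-high))
  ... | z′ , moves , desc′ = suc k ∷ z′ , LineMove⋆-∷ (suc k) moves ◅◅ (here ≤-refl ◅ ε) , high∷ desc′

  Descending-reaches : ∀ {n} {z y : Vec ℕ n} → Descending z → TwoValued k y → sum z ≡ sum y → Star LineMove z y
  Descending-reaches {z = []} _ [] _ = ε
  Descending-reaches (lows (refl ∷ all-low)) (inj₁ refl ∷ tv) e =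
    LineMove⋆-∷ k (Descending-reaches (lows all-low) tv (+-cancelˡ-≡ k _ _ e))
  Descending-reaches (lows (refl ∷ all-low)) (inj₂ refl ∷ tv) e = ⊥-elim (<⇒≢ (lows<TwoValued all-low tv) e)
  Descending-reaches (high∷ desc) (inj₂ refl ∷ tv) e =
    LineMove⋆-∷ (suc k) (Descending-reaches desc tv (+-cancelˡ-≡ (suc k) _ _ e))
  Descending-reaches {z = z} (high∷ desc) (inj₁ refl ∷ tv) e with all? (_≟ suc k) z
  ... | yes (_ ∷ all-high) = ⊥-elim (<⇒≢ (TwoValued<highs tv all-high) (sym e))
  ... | no not-all-high with Descending-shift (high∷ desc) not-all-high
  ... | z′ , moves , desc′ =
    moves ◅◅ LineMove⋆-∷ k (Descending-reaches desc′ tv (+-cancelˡ-≡ k _ _ (trans (LineMove⋆-sum moves) e)))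

  Ascending-TwoValued : ∀ {c n} {v : Vec ℕ n} → Ascending c v → TwoValued k v
  Ascending-TwoValued (highs all-high) = All.map inj₂ all-high
  Ascending-TwoValued (low∷ asc)       = inj₁ refl ∷ Ascending-TwoValued asc

  Ascending-zero : ∀ {n} {v : Vec ℕ n} → Ascending 0 v → All (_≡ k) v
  Ascending-zero (highs []) = []
  Ascending-zero (low∷ asc) = refl ∷ Ascending-zero asc

  Ascending-unique : ∀ {c c′ n} {a b : Vec ℕ n} → Ascending c a → Ascending c′ b → sum a ≡ sum b → a ≡ b
  Ascending-unique (highs all-high) (highs all-high′) _ = highs-unique all-high all-high′
    where
    highs-unique : ∀ {n} {a b : Vec ℕ n} → All (_≡ suc k) a → All (_≡ suc k) b → a ≡ b
    highs-unique []         []         = refl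
    highs-unique (refl ∷ a) (refl ∷ b) = cong (suc k ∷_) (highs-unique a b)
  Ascending-unique (low∷ asc) (low∷ asc′) e = cong (k ∷_) (Ascending-unique asc asc′ (+-cancelˡ-≡ k _ _ e))
  Ascending-unique (low∷ asc) (highs (refl ∷ all-high)) e =
    ⊥-elim (<⇒≢ (TwoValued<highs (Ascending-TwoValued asc) all-high) e)
  Ascending-unique (highs (refl ∷ all-high)) (low∷ asc′) e =
    ⊥-elim (<⇒≢ (TwoValued<highs (Ascending-TwoValued asc′) all-high) (sym e))

  Ascending-last : ∀ {c n} {v : Vec ℕ (suc n)} → Ascending (suc c) v → last v ≡ suc k × Ascending c (init v)
  Ascending-last (highs all-high) = All-last all-high , highs (All-init all-high)
  Ascending-last {n = zero}  (low∷ {v = []} ())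
  Ascending-last {n = suc n} (low∷ asc) with Ascending-last asc
  ... | last≡1+k , asc′ = last≡1+k , low∷ asc′

  -- HighPrefixed c v : v = (k+1) … (k+1) w with Ascending c w; rotating moves a trailing k + 1 to the prefix.
  data HighPrefixed (c : ℕ) : ∀ {n} → Vec ℕ n → Set where
    ascending : ∀ {n} {v : Vec ℕ n} → Ascending c v → HighPrefixed c v
    high∷     : ∀ {n} {v : Vec ℕ n} → HighPrefixed c v → HighPrefixed c (suc k ∷ v)

  HighPrefixed-last : ∀ {c n} {v : Vec ℕ (suc n)} → HighPrefixed (suc c) v → last v ≡ suc k × HighPrefixed c (init v)
  HighPrefixed-last (ascending asc) with Ascending-last asc
  ... | last≡1+k , asc′ = last≡1+k , ascending asc′
  HighPrefixed-last {n = zero}  (high∷ {v = []} (ascending ()))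
  HighPrefixed-last {n = suc n} (high∷ hp) with HighPrefixed-last hp
  ... | last≡1+k , hp′ = last≡1+k , high∷ hp′

  HighPrefixed-zero : ∀ {n} {v : Vec ℕ n} → HighPrefixed 0 v → Descending v
  HighPrefixed-zero (ascending asc) = lows (Ascending-zero asc)
  HighPrefixed-zero (high∷ hp)      = high∷ (HighPrefixed-zero hp)

  HighPrefixed-rotate : ∀ c {n} (v : Vec ℕ (suc n)) → HighPrefixed c v → ∃ λ j → Descending (iterate rotate v j)
  HighPrefixed-rotate zero    v hp = 0 , HighPrefixed-zero hp
  HighPrefixed-rotate (suc c) v hp with HighPrefixed-last hp
  ... | last≡1+k , hp′
    with HighPrefixed-rotate c (rotate v) (subst (λ x → HighPrefixed c (x ∷ init v)) (sym last≡1+k) (high∷ hp′))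
  ... | j , desc = suc j , desc

  LineMove⋆⇒Move⋆ : ∀ {n} {a b : Vec ℕ (suc n)} → Star LineMove a b → Star Move a b
  LineMove⋆⇒Move⋆ = gmap id LineMove⇒Move

  -- The wrap-around move from the last seat to the first, then re-sorting the remaining seats.
  Ascending-rotation : ∀ {m c} {S₀ : Vec ℕ (suc m)} → Ascending (suc c) (k ∷ S₀) →
    Star Move (k ∷ S₀) (rotate (k ∷ S₀))
  Ascending-rotation (highs (() ∷ _))
  Ascending-rotation {m} {S₀ = S₀} asc@(low∷ asc₀) with Ascending-last asc
  ... | last≡1+k , asc-init with sort (All-∷ʳ (All-init (Ascending-TwoValued asc₀)) (inj₁ refl))
  ... | _ , s′ , moves , asc′ =
    subst (Star Move (k ∷ S₀)) (cong₂ _∷_ (sym last≡1+k) s′≡init)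
      ((fromℕ (suc m) , wrap-around) ◅ LineMove⋆⇒Move⋆ (LineMove⋆-∷ (suc k) moves))
    where
    wrap-around : MoveAt (fromℕ (suc m)) (k ∷ S₀) (suc k ∷ (init S₀ ∷ʳ k))
    wrap-around rewrite next-fromℕ (suc m) =
      subst (k <_) (sym (trans (lookup-fromℕ S₀) last≡1+k)) ≤-refl ,
      cong (suc k ∷_) (sym (trans (updateAt-fromℕ S₀ _) (cong (λ x → init S₀ ∷ʳ (x ∸ 1)) last≡1+k)))
    s′≡init : s′ ≡ init (k ∷ S₀)
    s′≡init = Ascending-unique asc′ asc-init
      (trans (LineMove⋆-sum moves) (trans (sum-∷ʳ (init S₀) k) (+-comm (sum (init S₀)) k)))

  balanced-reach : ∀ {m} {x y : Vec ℕ (suc (suc m))} → Balanced k x → Balanced k y → sum x ≡ sum y → Star Move x y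
  balanced-reach (tv-x , k∈x , 1+k∈x) (tv-y , _) x≡y with sort tv-x
  ... | zero , S , x↝S , asc =
    ⊥-elim (<⇒≢ (sum-> tv-x 1+k∈x) (sym (trans (sym (LineMove⋆-sum x↝S)) (sum-lows (Ascending-zero asc)))))
  ... | suc c , S , x↝S , highs all-high =
    ⊥-elim (<⇒≢ (sum-< tv-x k∈x) (trans (sym (LineMove⋆-sum x↝S)) (sum-highs all-high)))
  ... | suc c , S , x↝S , asc@(low∷ _) with HighPrefixed-rotate (suc c) S (ascending asc)
  ... | j , desc =
    LineMove⋆⇒Move⋆ x↝S ◅◅ rotation-chain (Ascending-rotation asc) j ◅◅
    LineMove⋆⇒Move⋆ (Descending-reaches desc tv-y sums)
    where
    sums : sum (iterate rotate S j) ≡ _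
    sums = trans (iterate-rotate-invariant sum-rotate j S) (trans (LineMove⋆-sum x↝S) x≡y)

module _ {p n : ℕ} where

  SameSCC⇒Dual : {a b : Config p n} → a ≢ b → SameSCC a b → Dual a
  SameSCC⇒Dual a≢b (ε , _)        = ⊥-elim (a≢b refl)
  SameSCC⇒Dual a≢b (r ◅ rs , b↝a) = ◅-⁺ r (rs ◅◅ b↝a)

  Dual-respects-SameSCC : {a c : Config p n} → Dual a → SameSCC a c → Dual c
  Dual-respects-SameSCC dual-a (a↝c , c↝a) = ◅◅-⁺ c↝a (⁺-◅◅ dual-a a↝c)

Move⋆⇒Reach : ∀ {n} {a b : Vec ℕ (suc (suc m))} → Star Move a b →
  (sa : sum a ≡ n) (sb : sum b ≡ n) → Reach {suc (suc m)} {n} (a , sa) (b , sb)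
Move⋆⇒Reach ε        sa sb rewrite ≡-irrelevant sa sb = ε
Move⋆⇒Reach (mv ◅ s) sa sb = mv ◅ Move⋆⇒Reach s (trans (move-preserves-sum mv) sa) sb

Dual⇒Balanced : ∀ {n} {c : Config (suc (suc m)) n} → Dual c → ∃ λ k → Balanced k (proj₁ c)
Dual⇒Balanced cyc = cycle-balanced (⁺-gmap proj₁ id cyc)

balanced-level-unique : ∀ {n k k′} {x y : Vec ℕ (suc n)} → Balanced k x → Balanced k′ y → sum x ≡ sum y → k ≡ k′
balanced-level-unique {n} {k} {k′} {x} {y} (tv-x , k∈x , 1+k∈x) (tv-y , k′∈y , 1+k′∈y) x≡y =
  ≤-antisym (below (TV.sum-> k tv-x 1+k∈x) (TV.sum-< k′ tv-y k′∈y) x≡y)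
            (below (TV.sum-> k′ tv-y 1+k′∈y) (TV.sum-< k tv-x k∈x) (sym x≡y))
  where
  module TV = TwoValuedReachability
  below : ∀ {l l′ s s′} → suc n * l < s → s′ < suc n * suc l′ → s ≡ s′ → l ≤ l′
  below {l} {l′} lower upper refl = s≤s⁻¹ (*-cancelˡ-< (suc n) l (suc l′) (<-trans lower upper))

duals-strongly-connected : ∀ {n} {a c : Config (suc (suc m)) n} → Dual a → Dual c → SameSCC a c
duals-strongly-connected {a = x , sx} {y , sy} dual-x dual-y
  with Dual⇒Balanced {c = x , sx} dual-x | Dual⇒Balanced {c = y , sy} dual-y
... | k , bal-x | k′ , bal-y with balanced-level-unique bal-x bal-y (trans sx (sym sy))
... | refl = Move⋆⇒Reach (balanced-reach bal-x bal-y (trans sx (sym sy))) sx sy ,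
             Move⋆⇒Reach (balanced-reach bal-y bal-x (trans sy (sym sx))) sy sx
  where open TwoValuedReachability k

no-move-single-player : ∀ {a b : Vec ℕ 1} → ¬ Move a b
no-move-single-player (zero , lt , _) = <-irrefl refl lt

theorem2 : (p n : ℕ) → 1 ≤ p →
    ((a b c d : Config p n) → a ≢ b → SameSCC a b → c ≢ d → SameSCC c d → SameSCC a c)
    × ((a b : Config p n) → a ≢ b → SameSCC a b → (c : Config p n) → (Dual c ⇔ SameSCC a c))
theorem2 (suc zero) n _ =
  (λ a b c d a≢b a∼b _ _ → ⊥-elim (singleton-SCCs a≢b a∼b)) ,
  (λ a b a≢b a∼b c → ⊥-elim (singleton-SCCs a≢b a∼b))
  where
  singleton-SCCs : {a b : Config 1 n} → a ≢ b → ¬ SameSCC a b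
  singleton-SCCs a≢b (ε , _)      = a≢b refl
  singleton-SCCs a≢b (mv ◅ _ , _) = no-move-single-player mv
theorem2 (suc (suc m)) n _ =
  (λ a b c d a≢b a∼b c≢d c∼d → duals-strongly-connected (SameSCC⇒Dual a≢b a∼b) (SameSCC⇒Dual c≢d c∼d)) ,
  (λ a b a≢b a∼b c → let dual-a = SameSCC⇒Dual a≢b a∼b in
    mk⇔ (duals-strongly-connected dual-a) (Dual-respects-SameSCC dual-a))
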